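{- Let $H=([n],\mathcal{I})$ be an interval hypergraph, $G_1$ its conflict graph, and $q$ a positive integer. There exists a set $S\subseteq V(G_1)$ such that $|S\cap Q|=1$ for each $Q\in\mathcal{Q}_1$ and $|S\cap Q'|\le q$ for each $Q'\in\mathcal{Q}_2$ if and only if there is a conflict-free colouring of $H$ with $q$ non-zero colours.
   Context: An interval hypergraph is $H=([n],\mathcal{I})$ with hyperedges intervals $\{i,\dots,j\}\subseteq[n]$. A function $C:[n]\to\{0,1,\dots,q\}$ is a conflict-free colouring of $H$ with $q$ non-zero colours if every $I\in\mathcal{I}$ contains a non-zero colour $j$ with $|I\cap C^{ -1}(j)|=1$. The conflict graph $G_1$ has nodes $(I,v)$, $I\in\mathcal{I}$, $v\in I$; its edges are $E_{edge}$ = pairs of distinct nodes $(I,v),(I,u)$, and $E_{colour}$ = pairs $(I,v),(J,u)$ with $u\ne v$ and $\{u,v\}\subseteq I$ or $\{u,v\}\subseteq J$. $\mathcal{Q}_1$ is the family of cliques $\{(I,u):u\in I\}$, one for each $I\in\mathcal{I}$. $\mathcal{Q}_2$ is the family of maximal cliques of $G_1$ that contain at least one edge of $E_{colour}$. -}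

module Defs where

open import Data.Nat using (ℕ; zero; suc; _+_)
open import Data.Fin using (Fin; zero; suc; _≤?_; _≟_) renaming (_≤_ to _≤ᶠ_)
open import Data.Bool using (Bool; true; false; if_then_else_; _∧_)
open import Data.Product using (_×_; _,_; ∃; ∃-syntax)
open import Data.Sum using (_⊎_)
open import Relation.Binary.PropositionalEquality using (_≡_; _≢_)
open import Relation.Nullary.Decidable using (⌊_⌋)

Σᶠ : ∀ {n} → (Fin n → ℕ) → ℕ
Σᶠ {zero}  f = 0
Σᶠ {suc n} f = f zero + Σᶠ (λ i → f (suc i))

count : ∀ {n} → (Fin n → Bool) → ℕ
count p = Σᶠ (λ i → if p i then 1 else 0)

inI : ∀ {n} → Fin n → Fin n → Fin n → Bool
inI i j v = ⌊ i ≤? v ⌋ ∧ ⌊ v ≤? j ⌋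

-- An interval hypergraph ([n], 𝓘): edge i j = true iff the interval {i,…,j} ∈ 𝓘.
-- Hyperedges are (nonempty) intervals {i,…,j} with i ≤ j.
record IntervalHypergraph (n : ℕ) : Set where
  field
    edge     : Fin n → Fin n → Bool
    edge-i≤j : ∀ i j → edge i j ≡ true → i ≤ᶠ j
open IntervalHypergraph public

-- Candidate nodes (I , v) of G₁, with I = {i,…,j} encoded as (i , j).
Node : ℕ → Set
Node n = Fin n × Fin n × Fin n

NodeSet : ℕ → Set
NodeSet n = Node n → Bool

_∩_ : ∀ {n} → NodeSet n → NodeSet n → NodeSet n
(A ∩ B) x = A x ∧ B x

size : ∀ {n} → NodeSet n → ℕ
size A = Σᶠ (λ i → Σᶠ (λ j → count (λ v → A (i , j , v))))

isNode : ∀ {n} → IntervalHypergraph n → Node n → Bool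
isNode H (i , j , v) = edge H i j ∧ inI i j v

IsNode : ∀ {n} → IntervalHypergraph n → Node n → Set
IsNode H x = isNode H x ≡ true

EdgeE : ∀ {n} → IntervalHypergraph n → Node n → Node n → Set
EdgeE H x@(i , j , v) y@(k , l , u) =
  IsNode H x × IsNode H y × i ≡ k × j ≡ l × v ≢ u

ColourE : ∀ {n} → IntervalHypergraph n → Node n → Node n → Set
ColourE H x@(i , j , v) y@(k , l , u) =
  IsNode H x × IsNode H y × u ≢ v ×
  ((inI i j u ∧ inI i j v) ≡ true ⊎ (inI k l u ∧ inI k l v) ≡ true)

Adj : ∀ {n} → IntervalHypergraph n → Node n → Node n → Set
Adj H x y = EdgeE H x y ⊎ ColourE H x y

SubsetOfV : ∀ {n} → IntervalHypergraph n → NodeSet n → Set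
SubsetOfV H K = ∀ x → K x ≡ true → IsNode H x

IsClique : ∀ {n} → IntervalHypergraph n → NodeSet n → Set
IsClique H K =
  SubsetOfV H K ×
  (∀ x y → K x ≡ true → K y ≡ true → x ≢ y → Adj H x y)

IsMaximalClique : ∀ {n} → IntervalHypergraph n → NodeSet n → Set
IsMaximalClique H K =
  IsClique H K ×
  (∀ K′ → IsClique H K′ → (∀ x → K x ≡ true → K′ x ≡ true) →
     ∀ x → K′ x ≡ true → K x ≡ true)

Q₁ : ∀ {n} → Fin n → Fin n → NodeSet n
Q₁ i j (k , l , u) = ⌊ i ≟ k ⌋ ∧ ⌊ j ≟ l ⌋ ∧ inI i j u

In𝓠₂ : ∀ {n} → IntervalHypergraph n → NodeSet n → Set
In𝓠₂ H K =
  IsMaximalClique H K ×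
  ∃[ x ] ∃[ y ] (K x ≡ true × K y ≡ true × ColourE H x y)

GoodSet : ∀ {n} → IntervalHypergraph n → ℕ → NodeSet n → Set
GoodSet H q S =
  SubsetOfV H S ×
  (∀ i j → edge H i j ≡ true → size (S ∩ Q₁ i j) ≡ 1) ×
  (∀ K → In𝓠₂ H K → size (S ∩ K) Data.Nat.≤ q)

-- C : [n] → {0,1,…,q}; colour 0 (= zero) means "uncoloured".
Colouring : ℕ → ℕ → Set
Colouring n q = Fin n → Fin (suc q)

IsConflictFree : ∀ {n q} → IntervalHypergraph n → Colouring n q → Set
IsConflictFree {q = q} H C =
  ∀ i j → edge H i j ≡ true →
    ∃[ c ] (c ≢ zero × count (λ u → inI i j u ∧ ⌊ C u ≟ c ⌋) ≡ 1)

module Submission where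

-- If C is conflict-free, let every interval choose its vertex of unique colour. Two chosen
-- nodes of a clique of G₁ with equal colours would be two vertices of that colour inside one
-- interval, so a clique meets the chosen set at most once per nonzero colour.
--
-- Conversely, given S, call v chosen if (I , v) ∈ S for some I, and say that v reaches u if such
-- an I contains u, so that the points reached from v form an interval around v. A greedy sweep
-- from left to right colours the chosen points so that no point shares a colour with a point it
-- reaches or is reached by: a point joins, among the classes it is compatible with, the one whose
-- last point is greatest, and opens a new class otherwise. The sweep maintains a clique of the
-- reach graph with as many points as there are classes, so q colours suffice once every reach
-- clique Z has at most q points. That holds because of the least and the greatest point of Z one
-- reaches the other, so its interval contains all of Z; peeling such points off gives nodes of S
-- pairwise joined by colour edges, a clique inside a member of 𝓠₂. Finally, colour v by its class
-- if v is chosen and by 0 otherwise: the vertex chosen by I has a colour no other vertex of I shares.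

open import Defs
open import Data.Nat using (ℕ; zero; suc; _+_; _≤_; _<_; z≤n; s≤s; _<?_; _≤?_)
open import Data.Nat.Properties hiding (suc-injective)
open import Algebra.Properties.CommutativeSemigroup +-commutativeSemigroup using (interchange)
open import Data.Nat.DivMod using (_mod_; _%_; m<n⇒m%n≡m)
open import Data.Fin using (Fin; zero; suc; toℕ; fromℕ<) renaming (_≟_ to _≟ᶠ_; _≤?_ to _≤?ᶠ_)
open import Data.Fin.Properties
  using (toℕ<n; toℕ-fromℕ<; fromℕ<-toℕ; toℕ-injective; suc-injective; any?; all?) renaming (0≢1+n to zero≢suc)
open import Data.Bool using (Bool; true; false; if_then_else_; _∧_; _∨_; not) renaming (_≟_ to _≟ᵇ_)
open import Data.Bool.Properties using (¬-not; ∧-comm; ∧-identityʳ; ∧-zeroʳ; ∨-identityʳ)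
open import Data.Product using (_×_; _,_; ∃; ∃₂; ∃-syntax; proj₁; proj₂)
open import Data.Product.Properties using (≡-dec)
open import Data.Sum using (_⊎_; inj₁; inj₂; [_,_]′; map₁; map₂)
open import Data.Empty using (⊥; ⊥-elim)
open import Data.List using (List; []; _∷_; allFin; cartesianProduct)
open import Data.List.Membership.Propositional using (_∈_)
open import Data.List.Membership.Propositional.Properties using (∈-allFin; ∈-cartesianProduct⁺)
open import Data.List.Relation.Unary.Any using (here; there)
open import Relation.Nullary using (¬_; Dec; yes; no; contradiction)
open import Relation.Nullary.Decidable using (⌊_⌋; _×-dec_; _⊎-dec_; _→-dec_; ¬?)
open import Relation.Binary.PropositionalEquality
open import Relation.Binary.Definitions using (Tri; tri<; tri≈; tri>)
open import Function using (_∘_; id; case_of_)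
open import Function.Bundles using (_⇔_; mk⇔)

∧-intro : ∀ {a b} → a ≡ true → b ≡ true → a ∧ b ≡ true
∧-intro refl refl = refl

∧-elim : ∀ {a b} → a ∧ b ≡ true → a ≡ true × b ≡ true
∧-elim {true} b≡true = refl , b≡true

∨-introˡ : ∀ {a b} → a ≡ true → a ∨ b ≡ true
∨-introˡ refl = refl

∨-introʳ : ∀ {a b} → b ≡ true → a ∨ b ≡ true
∨-introʳ {true}  _      = refl
∨-introʳ {false} b≡true = b≡true

∨-elim : ∀ {a b} → a ∨ b ≡ true → a ≡ true ⊎ b ≡ true
∨-elim {true}  _      = inj₁ refl
∨-elim {false} b≡true = inj₂ b≡true

∧-swapʳ : ∀ a b c → (a ∧ b) ∧ c ≡ (a ∧ c) ∧ b
∧-swapʳ true  b c = ∧-comm b c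
∧-swapʳ false b c = refl

∧-absorbs-implied : ∀ {a b} → (a ≡ true → b ≡ true) → a ∧ b ≡ a
∧-absorbs-implied {false} _   = refl
∧-absorbs-implied {true}  a⇒b = a⇒b refl

true-or-false : ∀ a → a ≡ true ⊎ a ≡ false
true-or-false true  = inj₁ refl
true-or-false false = inj₂ refl

true≢false : ∀ {a} → a ≡ true → a ≡ false → ⊥
true≢false refl ()

≢true⇒false : ∀ {a} → (a ≡ true → ⊥) → a ≡ false
≢true⇒false = ¬-not

not-true : ∀ {a} → not a ≡ true → a ≡ false
not-true {false} _ = refl

not-false : ∀ {a} → a ≡ false → not a ≡ true
not-false refl = refl

⌊⌋⇒ : ∀ {A : Set} (a? : Dec A) → ⌊ a? ⌋ ≡ true → A
⌊⌋⇒ (yes a) _ = a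

⌊⌋-true : ∀ {A : Set} (a? : Dec A) → A → ⌊ a? ⌋ ≡ true
⌊⌋-true (yes _) _ = refl
⌊⌋-true (no ¬a) a = contradiction a ¬a

⌊⌋-false : ∀ {A : Set} (a? : Dec A) → ¬ A → ⌊ a? ⌋ ≡ false
⌊⌋-false (yes a) ¬a = contradiction a ¬a
⌊⌋-false (no _)  _  = refl

-- Counting

ind : Bool → ℕ
ind b = if b then 1 else 0

ind-mono : ∀ {a b} → (a ≡ true → b ≡ true) → ind a ≤ ind b
ind-mono {false} _   = z≤n
ind-mono {true}  a⇒b rewrite a⇒b refl = ≤-refl

Σᶠ-cong : ∀ {n} {f g : Fin n → ℕ} → (∀ i → f i ≡ g i) → Σᶠ f ≡ Σᶠ g
Σᶠ-cong {zero}  _   = refl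
Σᶠ-cong {suc n} f≗g = cong₂ _+_ (f≗g zero) (Σᶠ-cong (λ i → f≗g (suc i)))

Σᶠ-mono : ∀ {n} {f g : Fin n → ℕ} → (∀ i → f i ≤ g i) → Σᶠ f ≤ Σᶠ g
Σᶠ-mono {zero}  _   = z≤n
Σᶠ-mono {suc n} f≤g = +-mono-≤ (f≤g zero) (Σᶠ-mono (λ i → f≤g (suc i)))

Σᶠ-zero : ∀ {n} {f : Fin n → ℕ} → (∀ i → f i ≡ 0) → Σᶠ f ≡ 0
Σᶠ-zero {zero}  _  = refl
Σᶠ-zero {suc n} f0 = cong₂ _+_ (f0 zero) (Σᶠ-zero (f0 ∘ suc))

Σᶠ-const-1 : ∀ n → Σᶠ {n} (λ _ → 1) ≡ n
Σᶠ-const-1 zero    = refl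
Σᶠ-const-1 (suc n) = cong suc (Σᶠ-const-1 n)

Σᶠ-+ : ∀ {n} (f g : Fin n → ℕ) → Σᶠ (λ i → f i + g i) ≡ Σᶠ f + Σᶠ g
Σᶠ-+ {zero}  f g = refl
Σᶠ-+ {suc n} f g = trans (cong (f zero + g zero +_) (Σᶠ-+ (f ∘ suc) (g ∘ suc)))
                          (interchange (f zero) (g zero) (Σᶠ (f ∘ suc)) (Σᶠ (g ∘ suc)))

Σᶠ-swap : ∀ {n m} (f : Fin n → Fin m → ℕ) →
  Σᶠ (λ i → Σᶠ (λ j → f i j)) ≡ Σᶠ (λ j → Σᶠ (λ i → f i j))
Σᶠ-swap {zero}  {m} f = sym (Σᶠ-zero {m} (λ _ → refl))
Σᶠ-swap {suc n} f = trans (cong (Σᶠ (f zero) +_) (Σᶠ-swap (f ∘ suc)))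
                          (sym (Σᶠ-+ (f zero) (λ j → Σᶠ (λ i → f (suc i) j))))

Σᶠ-single : ∀ {n} (f : Fin n → ℕ) (k : Fin n) → (∀ i → i ≢ k → f i ≡ 0) → Σᶠ f ≡ f k
Σᶠ-single f zero    f0 =
  trans (cong (f zero +_) (Σᶠ-zero (λ i → f0 (suc i) λ ()))) (+-identityʳ (f zero))
Σᶠ-single f (suc k) f0 =
  trans (cong (_+ Σᶠ (f ∘ suc)) (f0 zero λ ()))
        (Σᶠ-single (f ∘ suc) k (λ i i≢k → f0 (suc i) (i≢k ∘ suc-injective)))

count-zero : ∀ {n} (p : Fin n → Bool) → (∀ i → p i ≡ false) → count p ≡ 0
count-zero p none = Σᶠ-zero (λ i → cong ind (none i))

count-mono : ∀ {n} (p r : Fin n → Bool) → (∀ i → p i ≡ true → r i ≡ true) → count p ≤ count r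
count-mono p r p⊆r = Σᶠ-mono (λ i → ind-mono (p⊆r i))

count-single : ∀ {n} (p : Fin n → Bool) (k : Fin n) → p k ≡ true →
  (∀ i → p i ≡ true → i ≡ k) → count p ≡ 1
count-single p k pk only-k = trans (Σᶠ-single _ k off-k) (cong ind pk)
  where
  off-k : ∀ i → i ≢ k → ind (p i) ≡ 0
  off-k i i≢k = cong ind (≢true⇒false (i≢k ∘ only-k i))

count-≥1 : ∀ {n} (p : Fin n → Bool) {a} → p a ≡ true → 1 ≤ count p
count-≥1 p {zero}  pa rewrite pa = s≤s z≤n
count-≥1 p {suc a} pa = ≤-trans (count-≥1 (p ∘ suc) pa) (m≤n+m _ (ind (p zero)))

count-≥2 : ∀ {n} (p : Fin n → Bool) {a b} → a ≢ b → p a ≡ true → p b ≡ true → 2 ≤ count p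
count-≥2 p {zero}  {zero}  a≢b _  _  = contradiction refl a≢b
count-≥2 p {zero}  {suc b} _   pa pb rewrite pa = s≤s (count-≥1 (p ∘ suc) pb)
count-≥2 p {suc a} {zero}  _   pa pb rewrite pb = s≤s (count-≥1 (p ∘ suc) pa)
count-≥2 p {suc a} {suc b} a≢b pa pb =
  ≤-trans (count-≥2 (p ∘ suc) (a≢b ∘ cong suc) pa pb) (m≤n+m _ (ind (p zero)))

count≡1⇒unique : ∀ {n} (p : Fin n → Bool) → count p ≡ 1 →
  ∀ {a b} → p a ≡ true → p b ≡ true → a ≡ b
count≡1⇒unique p count≡1 {a} {b} pa pb with a ≟ᶠ b
... | yes a≡b = a≡b
... | no  a≢b = contradiction (subst (2 ≤_) count≡1 (count-≥2 p a≢b pa pb)) λ { (s≤s ()) }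

count-witness : ∀ {n} (p : Fin n → Bool) → 1 ≤ count p → ∃ λ i → p i ≡ true
count-witness {suc n} p 1≤ with p zero in p0
... | true  = zero , p0
... | false = let i , pi = count-witness (p ∘ suc) 1≤ in suc i , pi

count-pair : ∀ {n} (p : Fin n → Bool) → 2 ≤ count p →
  ∃₂ λ a b → a ≢ b × p a ≡ true × p b ≡ true
count-pair {suc n} p 2≤ with p zero in p0
... | true  = let i , pi = count-witness (p ∘ suc) (≤-pred 2≤) in zero , suc i , (λ ()) , p0 , pi
... | false = let a , b , a≢b , pa , pb = count-pair (p ∘ suc) 2≤
              in suc a , suc b , a≢b ∘ suc-injective , pa , pb

any-node? : ∀ {n} {Q : Node n → Set} → (∀ x → Dec (Q x)) → Dec (∃ Q)
any-node? Q? with any? (λ i → any? (λ j → any? (λ v → Q? (i , j , v))))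
... | yes (i , j , v , Qx) = yes ((i , j , v) , Qx)
... | no  none             = no λ { ((i , j , v) , Qx) → none (i , j , v , Qx) }

all-nodes? : ∀ {n} {Q : Node n → Set} → (∀ x → Dec (Q x)) → Dec (∀ x → Q x)
all-nodes? Q? with all? (λ i → all? (λ j → all? (λ v → Q? (i , j , v))))
... | yes all = yes λ { (i , j , v) → all i j v }
... | no  ¬all = no λ all → ¬all λ i j v → all (i , j , v)

nonempty? : ∀ {n} (A : NodeSet n) → Dec (∃ λ x → A x ≡ true)
nonempty? A = any-node? (λ x → A x ≟ᵇ true)

size-zero : ∀ {n} (A : NodeSet n) → (∀ x → A x ≡ false) → size A ≡ 0
size-zero A none = Σᶠ-zero (λ i → Σᶠ-zero (λ j → count-zero _ (λ v → none (i , j , v))))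

size-mono : ∀ {n} (A B : NodeSet n) → (∀ x → A x ≡ true → B x ≡ true) → size A ≤ size B
size-mono A B A⊆B = Σᶠ-mono (λ i → Σᶠ-mono (λ j → count-mono _ _ (λ v → A⊆B (i , j , v))))

size-single : ∀ {n} (A : NodeSet n) (k : Node n) → A k ≡ true →
  (∀ x → A x ≡ true → x ≡ k) → size A ≡ 1
size-single A k@(a , b , c) Ak only-k =
  trans (Σᶠ-single _ a λ i i≢a → Σᶠ-zero λ j → count-zero _ λ v →
           off-k (i , j , v) (i≢a ∘ cong proj₁))
  (trans (Σᶠ-single _ b λ j j≢b → count-zero _ λ v →
           off-k (a , j , v) (j≢b ∘ cong (proj₁ ∘ proj₂)))
         (count-single _ c Ak λ v Av → cong (proj₂ ∘ proj₂) (only-k _ Av)))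
  where
  off-k : ∀ x → x ≢ k → A x ≡ false
  off-k x x≢k = ≢true⇒false (x≢k ∘ only-k x)

size-≤1 : ∀ {n} (A : NodeSet n) → (∀ x y → A x ≡ true → A y ≡ true → x ≡ y) → size A ≤ 1
size-≤1 A unique with nonempty? A
... | yes (k , Ak) = ≤-reflexive (size-single A k Ak (λ x Ax → unique x k Ax Ak))
... | no  empty    = ≤-trans (≤-reflexive (size-zero A λ x → ≢true⇒false λ Ax → empty (x , Ax))) z≤n

size-split : ∀ {n m} (A : NodeSet n) (f : Node n → Fin m) →
  size A ≡ Σᶠ (λ c → size (λ x → A x ∧ ⌊ f x ≟ᶠ c ⌋))
size-split {n} {m} A f = begin
  Σᶠ (λ i → Σᶠ (λ j → Σᶠ (λ v → ind (A (i , j , v)))))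
    ≡⟨ Σᶠ-cong (λ i → Σᶠ-cong (λ j → Σᶠ-cong (λ v → ind-split (i , j , v)))) ⟩
  Σᶠ (λ i → Σᶠ (λ j → Σᶠ (λ v → Σᶠ (λ c → a i j v c))))
    ≡⟨ Σᶠ-cong (λ i → Σᶠ-cong (λ j → Σᶠ-swap (a i j))) ⟩
  Σᶠ (λ i → Σᶠ (λ j → Σᶠ (λ c → Σᶠ (λ v → a i j v c))))
    ≡⟨ Σᶠ-cong (λ i → Σᶠ-swap (λ j c → Σᶠ (λ v → a i j v c))) ⟩
  Σᶠ (λ i → Σᶠ (λ c → Σᶠ (λ j → Σᶠ (λ v → a i j v c))))
    ≡⟨ Σᶠ-swap (λ i c → Σᶠ (λ j → Σᶠ (λ v → a i j v c))) ⟩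
  Σᶠ (λ c → Σᶠ (λ i → Σᶠ (λ j → Σᶠ (λ v → a i j v c)))) ∎
  where
  open ≡-Reasoning
  a : Fin n → Fin n → Fin n → Fin m → ℕ
  a i j v c = ind (A (i , j , v) ∧ ⌊ f (i , j , v) ≟ᶠ c ⌋)
  ind-split : ∀ x → ind (A x) ≡ Σᶠ (λ c → ind (A x ∧ ⌊ f x ≟ᶠ c ⌋))
  ind-split x with A x
  ... | false = sym (Σᶠ-zero {m} λ _ → refl)
  ... | true  = sym (count-single (λ c → ⌊ f x ≟ᶠ c ⌋) (f x) (⌊⌋-true (f x ≟ᶠ f x) refl)
                                  (λ c fx≟c → sym (⌊⌋⇒ (f x ≟ᶠ c) fx≟c)))

size-≤-colours : ∀ {n q} (A : NodeSet n) (f : Node n → Fin (suc q)) →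
  (∀ x → A x ≡ true → f x ≢ zero) →
  (∀ x y → A x ≡ true → A y ≡ true → f x ≡ f y → x ≡ y) → size A ≤ q
size-≤-colours {q = q} A f nonzero injective = begin
  size A                                         ≡⟨ size-split A f ⟩
  size (class zero) + Σᶠ (λ c → size (class (suc c)))
    ≤⟨ +-mono-≤ (≤-reflexive (size-zero (class zero) no-zero))
                (Σᶠ-mono (λ c → size-≤1 (class (suc c)) (in-class-unique (suc c)))) ⟩
  Σᶠ {q} (λ _ → 1)                               ≡⟨ Σᶠ-const-1 q ⟩
  q                                              ∎
  where
  open ≤-Reasoning
  class : Fin (suc q) → NodeSet _
  class c x = A x ∧ ⌊ f x ≟ᶠ c ⌋
  no-zero : ∀ x → class zero x ≡ false
  no-zero x = ≢true⇒false λ x∈ →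
    let Ax , fx≟0 = ∧-elim x∈ in nonzero x Ax (⌊⌋⇒ (f x ≟ᶠ zero) fx≟0)
  in-class-unique : ∀ c x y → class c x ≡ true → class c y ≡ true → x ≡ y
  in-class-unique c x y x∈ y∈ =
    let Ax , fx≟c = ∧-elim x∈ ; Ay , fy≟c = ∧-elim y∈
    in injective x y Ax Ay (trans (⌊⌋⇒ (f x ≟ᶠ c) fx≟c) (sym (⌊⌋⇒ (f y ≟ᶠ c) fy≟c)))

nodesOn : ∀ {n} → (Fin n → Bool) → (Fin n → Fin n × Fin n) → NodeSet n
nodesOn X I (i , j , u) = ⌊ i ≟ᶠ proj₁ (I u) ⌋ ∧ ⌊ j ≟ᶠ proj₂ (I u) ⌋ ∧ X u

nodesOn-elim : ∀ {n} (X : Fin n → Bool) I {i j u} → nodesOn X I (i , j , u) ≡ true →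
  (i , j) ≡ I u × X u ≡ true
nodesOn-elim X I {i} {j} {u} x∈ =
  let i≟ , rest = ∧-elim x∈ ; j≟ , Xu = ∧-elim rest
  in cong₂ _,_ (⌊⌋⇒ (i ≟ᶠ _) i≟) (⌊⌋⇒ (j ≟ᶠ _) j≟) , Xu

nodesOn-intro : ∀ {n} (X : Fin n → Bool) I {u} → X u ≡ true →
  nodesOn X I (proj₁ (I u) , proj₂ (I u) , u) ≡ true
nodesOn-intro X I {u} Xu =
  ∧-intro (⌊⌋-true (proj₁ (I u) ≟ᶠ _) refl) (∧-intro (⌊⌋-true (proj₂ (I u) ≟ᶠ _) refl) Xu)

size-nodesOn : ∀ {n} (X : Fin n → Bool) (I : Fin n → Fin n × Fin n) →
  size (nodesOn X I) ≡ count X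
size-nodesOn X I =
  trans (Σᶠ-cong (λ i → Σᶠ-swap (λ j u → ind (nodesOn X I (i , j , u)))))
  (trans (Σᶠ-swap (λ i u → Σᶠ (λ j → ind (nodesOn X I (i , j , u)))))
         (Σᶠ-cong at))
  where
  at : ∀ u → Σᶠ (λ i → Σᶠ (λ j → ind (nodesOn X I (i , j , u)))) ≡ ind (X u)
  at u with I u
  ... | (a , b) =
    trans (Σᶠ-single _ a λ i i≢a → Σᶠ-zero λ j →
             cong (λ d → ind (d ∧ ⌊ j ≟ᶠ b ⌋ ∧ X u)) (⌊⌋-false (i ≟ᶠ a) i≢a))
    (trans (Σᶠ-single _ b λ j j≢b →
             cong₂ (λ d e → ind (d ∧ e ∧ X u)) (⌊⌋-true (a ≟ᶠ a) refl) (⌊⌋-false (j ≟ᶠ b) j≢b))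
           (cong₂ (λ d e → ind (d ∧ e ∧ X u)) (⌊⌋-true (a ≟ᶠ a) refl) (⌊⌋-true (b ≟ᶠ b) refl)))

ℕSet : Set
ℕSet = ℕ → Bool

_⊆_ : ℕSet → ℕSet → Set
A ⊆ B = ∀ {x} → A x ≡ true → B x ≡ true

_∩ℕ_ : ℕSet → ℕSet → ℕSet
(A ∩ℕ B) x = A x ∧ B x

insert : ℕ → ℕSet → ℕSet
insert t A x = A x ∨ ⌊ x ≟ t ⌋

remove : ℕ → ℕSet → ℕSet
remove u A x = A x ∧ not ⌊ x ≟ u ⌋

below : ℕ → ℕSet
below t x = ⌊ x <? t ⌋

countBelow : ℕ → ℕSet → ℕ
countBelow zero    A = 0
countBelow (suc t) A = countBelow t A + ind (A t)

countBelow-cong : ∀ t {A B} → (∀ {x} → x < t → A x ≡ B x) → countBelow t A ≡ countBelow t B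
countBelow-cong zero    _   = refl
countBelow-cong (suc t) A≗B =
  cong₂ _+_ (countBelow-cong t (A≗B ∘ m<n⇒m<1+n)) (cong ind (A≗B (n<1+n t)))

countBelow-mono : ∀ t {A B} → (∀ {x} → x < t → A x ≡ true → B x ≡ true) →
  countBelow t A ≤ countBelow t B
countBelow-mono zero    _   = z≤n
countBelow-mono (suc t) A⊆B =
  +-mono-≤ (countBelow-mono t (A⊆B ∘ m<n⇒m<1+n)) (ind-mono (A⊆B (n<1+n t)))

countBelow-false : ∀ t {A} → A t ≡ false → countBelow (suc t) A ≡ countBelow t A
countBelow-false t At rewrite At = +-identityʳ _

countBelow-true : ∀ t {A} → A t ≡ true → countBelow (suc t) A ≡ suc (countBelow t A)
countBelow-true t At rewrite At = +-comm _ 1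

countBelow-remove : ∀ t {A u} → u < t → A u ≡ true →
  countBelow t A ≡ suc (countBelow t (remove u A))
countBelow-remove (suc t) {A} {u} u<1+t Au with m<1+n⇒m<n∨m≡n u<1+t
... | inj₂ refl = begin
  countBelow (suc t) A             ≡⟨ countBelow-true t Au ⟩
  suc (countBelow t A)             ≡⟨ cong suc (countBelow-cong t λ x<t → sym (keeps x<t)) ⟩
  suc (countBelow t (remove t A))  ≡⟨ cong suc (countBelow-false t removed) ⟨
  suc (countBelow (suc t) (remove t A)) ∎
  where
  open ≡-Reasoning
  keeps : ∀ {x} → x < t → remove t A x ≡ A x
  keeps {x} x<t rewrite ⌊⌋-false (x ≟ t) (<⇒≢ x<t) = ∧-identityʳ (A x)
  removed : remove t A t ≡ false
  removed rewrite ⌊⌋-true (t ≟ t) refl = ∧-zeroʳ (A t)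
... | inj₁ u<t = begin
  countBelow t A + ind (A t)                           ≡⟨ cong (_+ ind (A t)) (countBelow-remove t u<t Au) ⟩
  suc (countBelow t (remove u A)) + ind (A t)          ≡⟨ cong (λ b → suc (countBelow t (remove u A) + ind b)) kept ⟨
  suc (countBelow t (remove u A) + ind (remove u A t)) ∎
  where
  open ≡-Reasoning
  kept : remove u A t ≡ A t
  kept rewrite ⌊⌋-false (t ≟ u) (<⇒≢ u<t ∘ sym) = ∧-identityʳ (A t)

countBelow-count : ∀ m (A : ℕSet) → countBelow m A ≡ count {m} (A ∘ toℕ)
countBelow-count zero    A = refl
countBelow-count (suc m) A = begin
  countBelow (suc m) A                   ≡⟨ countBelow-front m A ⟩
  ind (A 0) + countBelow m (A ∘ suc)     ≡⟨ cong (ind (A 0) +_) (countBelow-count m (A ∘ suc)) ⟩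
  ind (A 0) + count {m} (A ∘ suc ∘ toℕ)  ∎
  where
  open ≡-Reasoning
  countBelow-front : ∀ m (A : ℕSet) → countBelow (suc m) A ≡ ind (A 0) + countBelow m (A ∘ suc)
  countBelow-front zero    A = +-comm 0 _
  countBelow-front (suc m) A rewrite countBelow-front m A = +-assoc (ind (A 0)) _ _

insert-new : ∀ t (A : ℕSet) → insert t A t ≡ true
insert-new t A = ∨-introʳ {A t} (⌊⌋-true (t ≟ t) refl)

insert-old : ∀ t (A : ℕSet) {x} → A x ≡ true → insert t A x ≡ true
insert-old t A = ∨-introˡ

insert-other : ∀ t (A : ℕSet) {x} → x ≢ t → insert t A x ≡ A x
insert-other t A {x} x≢t rewrite ⌊⌋-false (x ≟ t) x≢t = ∨-identityʳ (A x)

insert-cases : ∀ t (A : ℕSet) {x} → insert t A x ≡ true → A x ≡ true ⊎ x ≡ t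
insert-cases t A {x} x∈ = map₂ (⌊⌋⇒ (x ≟ t)) (∨-elim x∈)

countBelow-insert : ∀ t (A : ℕSet) → countBelow (suc t) (insert t A) ≡ suc (countBelow t A)
countBelow-insert t A = trans (countBelow-true t (insert-new t A))
                              (cong suc (countBelow-cong t (insert-other t A ∘ <⇒≢)))

least-below : (A : ℕSet) (t : ℕ) →
  (∀ {e} → e < t → A e ≡ false) ⊎
  ∃ λ m → A m ≡ true × m < t × (∀ {e} → e < t → A e ≡ true → m ≤ e)
least-below A zero = inj₁ λ ()
least-below A (suc t) with least-below A t | A t in At
... | inj₂ (m , Am , m<t , min) | _ =
  inj₂ (m , Am , m<n⇒m<1+n m<t , λ e<1+t Ae → [ (λ e<t → min e<t Ae) , (λ { refl → <⇒≤ m<t }) ]′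
                                                  (m<1+n⇒m<n∨m≡n e<1+t))
... | inj₁ none | true  =
  inj₂ (t , At , n<1+n t , λ e<1+t Ae → [ (λ e<t → ⊥-elim (true≢false Ae (none e<t))) ,
                                           (λ { refl → ≤-refl }) ]′ (m<1+n⇒m<n∨m≡n e<1+t))
... | inj₁ none | false =
  inj₁ λ e<1+t → [ none , (λ { refl → At }) ]′ (m<1+n⇒m<n∨m≡n e<1+t)

greatest-below : (A : ℕSet) (t : ℕ) →
  (∀ {e} → e < t → A e ≡ false) ⊎
  ∃ λ u → A u ≡ true × u < t × (∀ {e} → e < t → A e ≡ true → e ≤ u)
greatest-below A zero = inj₁ λ ()
greatest-below A (suc t) with A t in At | greatest-below A t
... | true  | _ = inj₂ (t , At , n<1+n t , λ e<1+t _ → m<1+n⇒m≤n e<1+t)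
... | false | inj₂ (u , Au , u<t , max) =
  inj₂ (u , Au , m<n⇒m<1+n u<t , λ e<1+t Ae → [ (λ e<t → max e<t Ae) , (λ { refl → ⊥-elim (true≢false Ae At) }) ]′
                                                  (m<1+n⇒m<n∨m≡n e<1+t))
... | false | inj₁ none =
  inj₁ λ e<1+t → [ none , (λ { refl → At }) ]′ (m<1+n⇒m<n∨m≡n e<1+t)

-- Colouring a reach graph

-- R x y reads "x reaches y"; the points reached from x form an interval around x.
module ReachColouring
  (P : ℕSet) (R : ℕ → ℕ → Bool)
  (reach-right : ∀ {x y z} → x < y → y ≤ z → R x z ≡ true → R x y ≡ true)
  (reach-left  : ∀ {x y z} → z ≤ y → y < x → R x z ≡ true → R x y ≡ true)
  where

  Adjacent : ℕ → ℕ → Bool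
  Adjacent x y = R x y ∨ R y x

  Apart : ℕ → ℕ → Set
  Apart x y = R x y ≡ false × R y x ≡ false

  apart : ∀ {x y} → Adjacent x y ≡ false → Apart x y
  apart {x} {y} ¬adj with R x y | R y x
  ... | false | false = refl , refl

  IsReachClique : ℕSet → Set
  IsReachClique X = ∀ {x y} → X x ≡ true → X y ≡ true → x < y → Adjacent x y ≡ true

  HasReachClique : ℕ → ℕSet → ℕ → Set
  HasReachClique s U k = ∃ λ X → X ⊆ U × IsReachClique X × k ≤ countBelow s X

  record Admissible (t : ℕ) (U : ℕSet) : Set where
    field
      ⊆P                : U ⊆ P
      <t                : ∀ {x} → U x ≡ true → x < t
      reaches-or-closed : ∀ {x} → U x ≡ true →
        R x t ≡ true ⊎ (∀ {y} → x ≤ y → y < t → P y ≡ true → U y ≡ true)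

  CliqueBound : ℕ → ℕSet → Set
  CliqueBound t E = ∀ {U} → Admissible t U → HasReachClique t U (countBelow t (E ∩ℕ U))

  restrict-admissible : ∀ {t U} → Admissible (suc t) U → Admissible t (U ∩ℕ below t)
  restrict-admissible {t} {U} adm = record
    { ⊆P = ⊆P ∘ proj₁ ∘ ∧-elim
    ; <t = λ x∈ → ⌊⌋⇒ (_ <? t) (proj₂ (∧-elim x∈))
    ; reaches-or-closed = λ x∈ →
        let Ux , x<t = ∧-elim x∈ in
        case reaches-or-closed Ux of λ
          { (inj₁ Rx[1+t]) → inj₁ (reach-right (⌊⌋⇒ (_ <? t) x<t) (n≤1+n t) Rx[1+t])
          ; (inj₂ closed)  → inj₂ λ {y} x≤y y<t Py →
              ∧-intro (closed x≤y (m<n⇒m<1+n y<t) Py) (⌊⌋-true (y <? t) y<t) }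
    }
    where open Admissible adm

  clique-bound-via-restriction : ∀ {t E U} → Admissible (suc t) U → CliqueBound t E →
    HasReachClique (suc t) U (countBelow t (E ∩ℕ U))
  clique-bound-via-restriction {t} {E} {U} adm bound =
    let X , X⊆ , clique , size≥ = bound (restrict-admissible adm)
        X-below : ∀ {x} → X x ≡ true → x < t
        X-below = λ x∈ → ⌊⌋⇒ (_ <? t) (proj₂ (∧-elim (X⊆ x∈)))
    in X , proj₁ ∘ ∧-elim ∘ X⊆ , clique , (begin
      countBelow t (E ∩ℕ U)                 ≡⟨ countBelow-cong t (λ {x} x<t → cong (E x ∧_) (sym
                                                 (trans (cong (U x ∧_) (⌊⌋-true (x <? t) x<t)) (∧-identityʳ (U x))))) ⟩
      countBelow t (E ∩ℕ (U ∩ℕ below t))    ≤⟨ size≥ ⟩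
      countBelow t X                        ≡⟨ countBelow-false t (≢true⇒false (<-irrefl refl ∘ X-below)) ⟨
      countBelow (suc t) X                  ∎)
    where open ≤-Reasoning

  t∉admissible⇒clique : ∀ {t U} → Admissible (suc t) U → P t ≡ true → U t ≡ false → IsReachClique U
  t∉admissible⇒clique {t} adm Pt Ut {x} {y} Ux Uy x<y with reaches-or-closed Ux
    where open Admissible adm
  ... | inj₁ Rx[1+t] = ∨-introˡ (reach-right x<y (<⇒≤ (Admissible.<t adm Uy)) Rx[1+t])
  ... | inj₂ closed  = ⊥-elim (true≢false (closed (m<1+n⇒m≤n (Admissible.<t adm Ux)) (n<1+n t) Pt) Ut)

  Neighbours : ℕ → ℕSet → ℕSet
  Neighbours t U x = U x ∧ below t x ∧ Adjacent x t

  neighbours-elim : ∀ t U {x} → Neighbours t U x ≡ true → U x ≡ true × x < t × Adjacent x t ≡ true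
  neighbours-elim t U x∈ = let Ux , rest = ∧-elim x∈ ; x<t , adj = ∧-elim rest
                           in Ux , ⌊⌋⇒ (_ <? t) x<t , adj

  neighbours-admissible : ∀ {t U} → Admissible (suc t) U → Admissible t (Neighbours t U)
  neighbours-admissible {t} {U} adm = record
    { ⊆P = ⊆P ∘ proj₁ ∘ neighbours-elim t U
    ; <t = proj₁ ∘ proj₂ ∘ neighbours-elim t U
    ; reaches-or-closed = λ x∈ →
        let Ux , x<t , adj = neighbours-elim t U x∈ in
        case ∨-elim adj , reaches-or-closed Ux of λ
          { (inj₁ Rxt , _)            → inj₁ Rxt
          ; (inj₂ Rtx , inj₁ Rx[1+t]) → inj₁ (reach-right x<t (n≤1+n t) Rx[1+t])
          ; (inj₂ Rtx , inj₂ closed)  → inj₂ λ {y} x≤y y<t Py →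
              ∧-intro (closed x≤y (m<n⇒m<1+n y<t) Py)
                      (∧-intro (⌊⌋-true (y <? t) y<t) (∨-introʳ (reach-left x≤y y<t Rtx))) }
    }
    where open Admissible adm

  insert-clique : ∀ {t U X} → IsReachClique X → X ⊆ Neighbours t U → IsReachClique (insert t X)
  insert-clique {t} {U} {X} clique X⊆N x∈ y∈ x<y with insert-cases t X x∈ | insert-cases t X y∈
  ... | inj₁ x∈X  | inj₁ y∈X  = clique x∈X y∈X x<y
  ... | inj₁ x∈X  | inj₂ refl = proj₂ (proj₂ (neighbours-elim t U (X⊆N x∈X)))
  ... | inj₂ refl | inj₁ y∈X  = ⊥-elim (<-asym x<y (proj₁ (proj₂ (neighbours-elim t U (X⊆N y∈X)))))
  ... | inj₂ refl | inj₂ refl = ⊥-elim (<-irrefl refl x<y)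

  clique-bound-via-neighbours : ∀ {t E E′ U} → Admissible (suc t) U → U t ≡ true → CliqueBound t E →
    (∀ {x} → x < t → E′ x ≡ true → U x ≡ true → E x ≡ true × Adjacent x t ≡ true) →
    HasReachClique (suc t) U (suc (countBelow t (E′ ∩ℕ U)))
  clique-bound-via-neighbours {t} {E} {E′} {U} adm Ut bound old-adjacent =
    let X , X⊆N , clique , size≥ = bound (neighbours-admissible adm)
    in insert t X ,
       (λ x∈ → [ proj₁ ∘ neighbours-elim t U ∘ X⊆N , (λ { refl → Ut }) ]′ (insert-cases t X x∈)) ,
       insert-clique {U = U} clique X⊆N , (begin
         suc (countBelow t (E′ ∩ℕ U))              ≤⟨ s≤s (countBelow-mono t E′∩U⊆E∩N) ⟩
         suc (countBelow t (E ∩ℕ Neighbours t U))  ≤⟨ s≤s size≥ ⟩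
         suc (countBelow t X)                      ≡⟨ countBelow-insert t X ⟨
         countBelow (suc t) (insert t X)           ∎)
    where
    open ≤-Reasoning
    E′∩U⊆E∩N : ∀ {x} → x < t → (E′ ∩ℕ U) x ≡ true → (E ∩ℕ Neighbours t U) x ≡ true
    E′∩U⊆E∩N x<t x∈ = let E′x , Ux = ∧-elim x∈ ; Ex , adj = old-adjacent x<t E′x Ux
                      in ∧-intro Ex (∧-intro Ux (∧-intro (⌊⌋-true (_ <? t) x<t) adj))

  clique-bound-if-t∉ : ∀ {t E U} → Admissible (suc t) U → P t ≡ true → U t ≡ false →
    HasReachClique (suc t) U (countBelow (suc t) (E ∩ℕ U))
  clique-bound-if-t∉ {E = E} adm Pt Ut =
    E ∩ℕ _ , proj₂ ∘ ∧-elim ,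
    (λ x∈ y∈ → t∉admissible⇒clique adm Pt Ut (proj₂ (∧-elim x∈)) (proj₂ (∧-elim y∈))) , ≤-refl

  -- The greedy sweep has coloured every x < t; ends holds the last point of each colour class.
  record Greedy (t : ℕ) : Set where
    field
      ends          : ℕSet
      colour        : ℕ → ℕ
      end∈P         : ends ⊆ P
      end<t         : ∀ {e} → ends e ≡ true → e < t
      proper        : ∀ {x y} → P x ≡ true → P y ≡ true → x < y → y < t →
                      colour x ≡ colour y → Apart x y
      end-above     : ∀ {x} → P x ≡ true → x < t →
                      ∃ λ e → ends e ≡ true × colour e ≡ colour x × x ≤ e
      ends-distinct : ∀ {e e′} → ends e ≡ true → ends e′ ≡ true → colour e ≡ colour e′ → e ≡ e′
      colour<       : ∀ {x} → P x ≡ true → x < t → colour x < countBelow t ends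
      clique-bound  : CliqueBound t ends

  start : Greedy 0
  start = record
    { ends = λ _ → false ; colour = λ _ → 0
    ; end∈P = λ () ; end<t = λ () ; proper = λ _ _ _ () ; end-above = λ _ ()
    ; ends-distinct = λ () ; colour< = λ _ ()
    ; clique-bound = λ _ → (λ _ → false) , (λ ()) , (λ ()) , z≤n
    }

  recolour : ℕ → ℕ → (ℕ → ℕ) → ℕ → ℕ
  recolour t c colour x = if ⌊ x ≟ t ⌋ then c else colour x

  recolour-new : ∀ t c colour → recolour t c colour t ≡ c
  recolour-new t c colour rewrite ⌊⌋-true (t ≟ t) refl = refl

  recolour-old : ∀ t c colour {x} → x < t → recolour t c colour x ≡ colour x
  recolour-old t c colour {x} x<t rewrite ⌊⌋-false (x ≟ t) (<⇒≢ x<t) = refl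

  Compatible : ℕSet → ℕ → ℕSet
  Compatible ends t e = ends e ∧ not (Adjacent e t)

  module _ {t} (G : Greedy t) where
    open Greedy G

    skip : P t ≡ false → Greedy (suc t)
    skip Pt = record
      { ends = ends ; colour = colour ; end∈P = end∈P
      ; end<t = m<n⇒m<1+n ∘ end<t
      ; proper = λ Px Py x<y y<1+t → proper Px Py x<y (old Py y<1+t)
      ; end-above = λ Px x<1+t → end-above Px (old Px x<1+t)
      ; ends-distinct = ends-distinct
      ; colour< = λ Px x<1+t → subst (colour _ <_) (sym (countBelow-false t ends-t)) (colour< Px (old Px x<1+t))
      ; clique-bound = λ {U} adm →
          let X , X⊆U , clique , size≥ = clique-bound-via-restriction adm clique-bound
          in X , X⊆U , clique ,
             subst (_≤ countBelow (suc t) X) (sym (countBelow-false t (cong (_∧ U t) ends-t))) size≥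
      }
      where
      old : ∀ {x} → P x ≡ true → x < suc t → x < t
      old Px x<1+t = ≤∧≢⇒< (m<1+n⇒m≤n x<1+t) λ { refl → true≢false Px Pt }
      ends-t : ends t ≡ false
      ends-t = ≢true⇒false (<-irrefl refl ∘ end<t)

    open-class : P t ≡ true → (∀ {e} → e < t → Compatible ends t e ≡ false) → Greedy (suc t)
    open-class Pt none = record
      { ends = ends′ ; colour = colour′
      ; end∈P = λ e∈ → [ end∈P , (λ { refl → Pt }) ]′ (insert-cases t ends e∈)
      ; end<t = λ e∈ → [ m<n⇒m<1+n ∘ end<t , (λ { refl → n<1+n t }) ]′ (insert-cases t ends e∈)
      ; proper = proper′
      ; end-above = end-above′
      ; ends-distinct = ends-distinct′
      ; colour< = colour<′
      ; clique-bound = clique-bound′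
      }
      where
      ends′ : ℕSet
      ends′ = insert t ends
      colour′ : ℕ → ℕ
      colour′ = recolour t (countBelow t ends) colour

      adjacent-to-t : ∀ {e} → e < t → ends e ≡ true → Adjacent e t ≡ true
      adjacent-to-t {e} e<t ends-e with Adjacent e t in adj
      ... | true  = refl
      ... | false = ⊥-elim (true≢false (∧-intro ends-e (not-false adj)) (none e<t))

      new≢old : ∀ {x} → P x ≡ true → x < t → colour′ x ≢ colour′ t
      new≢old {x} Px x<t same = <-irrefl (trans (sym (recolour-old t _ colour x<t)) (trans same (recolour-new t _ colour)))
                                           (colour< Px x<t)

      proper′ : ∀ {x y} → P x ≡ true → P y ≡ true → x < y → y < suc t → colour′ x ≡ colour′ y → Apart x y
      proper′ {x} {y} Px Py x<y y<1+t same with m<1+n⇒m<n∨m≡n y<1+t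
      ... | inj₁ y<t  = proper Px Py x<y y<t (trans (sym (recolour-old t _ colour (<-trans x<y y<t)))
                                                    (trans same (recolour-old t _ colour y<t)))
      ... | inj₂ refl = ⊥-elim (new≢old Px x<y same)

      end-above′ : ∀ {x} → P x ≡ true → x < suc t → ∃ λ e → ends′ e ≡ true × colour′ e ≡ colour′ x × x ≤ e
      end-above′ {x} Px x<1+t with m<1+n⇒m<n∨m≡n x<1+t
      ... | inj₂ refl = t , insert-new t ends , refl , ≤-refl
      ... | inj₁ x<t  = let e , ends-e , same , x≤e = end-above Px x<t in
        e , insert-old t ends ends-e ,
        trans (recolour-old t _ colour (end<t ends-e)) (trans same (sym (recolour-old t _ colour x<t))) , x≤e

      ends-distinct′ : ∀ {e e′} → ends′ e ≡ true → ends′ e′ ≡ true → colour′ e ≡ colour′ e′ → e ≡ e′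
      ends-distinct′ e∈ e′∈ same with insert-cases t ends e∈ | insert-cases t ends e′∈
      ... | inj₂ refl | inj₂ refl = refl
      ... | inj₁ ends-e | inj₂ refl = ⊥-elim (new≢old (end∈P ends-e) (end<t ends-e) same)
      ... | inj₂ refl | inj₁ ends-e′ = ⊥-elim (new≢old (end∈P ends-e′) (end<t ends-e′) (sym same))
      ... | inj₁ ends-e | inj₁ ends-e′ =
        ends-distinct ends-e ends-e′ (trans (sym (recolour-old t _ colour (end<t ends-e)))
                                            (trans same (recolour-old t _ colour (end<t ends-e′))))

      colour<′ : ∀ {x} → P x ≡ true → x < suc t → colour′ x < countBelow (suc t) ends′
      colour<′ {x} Px x<1+t rewrite countBelow-insert t ends with m<1+n⇒m<n∨m≡n x<1+t
      ... | inj₂ refl rewrite recolour-new t (countBelow t ends) colour = n<1+n _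
      ... | inj₁ x<t  rewrite recolour-old t (countBelow t ends) colour x<t = m<n⇒m<1+n (colour< Px x<t)

      clique-bound′ : CliqueBound (suc t) ends′
      clique-bound′ {U} adm with true-or-false (U t)
      ... | inj₂ Ut = clique-bound-if-t∉ adm Pt Ut
      ... | inj₁ Ut = subst (HasReachClique (suc t) U) (sym (countBelow-true t (∧-intro (insert-new t ends) Ut)))
                      (clique-bound-via-neighbours adm Ut clique-bound λ {x} x<t ends′-x _ →
                         let ends-x = [ id , (λ { refl → ⊥-elim (<-irrefl refl x<t) }) ]′ (insert-cases t ends ends′-x)
                         in ends-x , adjacent-to-t x<t ends-x)

    join-class : P t ≡ true → ∀ {u} → Compatible ends t u ≡ true → u < t →
      (∀ {e} → e < t → Compatible ends t e ≡ true → e ≤ u) → Greedy (suc t)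
    join-class Pt {u} compatible-u u<t greatest = record
      { ends = ends′ ; colour = colour′
      ; end∈P = λ e∈ → [ end∈P ∘ proj₁ , (λ { refl → Pt }) ]′ (ends′-cases e∈)
      ; end<t = λ e∈ → [ m<n⇒m<1+n ∘ end<t ∘ proj₁ , (λ { refl → n<1+n t }) ]′ (ends′-cases e∈)
      ; proper = proper′
      ; end-above = end-above′
      ; ends-distinct = ends-distinct′
      ; colour< = colour<′
      ; clique-bound = clique-bound′
      }
      where
      ends′ : ℕSet
      ends′ = insert t (remove u ends)
      colour′ : ℕ → ℕ
      colour′ = recolour t (colour u) colour

      ends-u : ends u ≡ true
      ends-u = proj₁ (∧-elim compatible-u)
      Pu : P u ≡ true
      Pu = end∈P ends-u
      apart-u : Apart u t
      apart-u = apart (not-true (proj₂ (∧-elim compatible-u)))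

      ends′-cases : ∀ {e} → ends′ e ≡ true → (ends e ≡ true × e ≢ u) ⊎ e ≡ t
      ends′-cases {e} e∈ = map₁ (λ e∈′ → let ends-e , e≉u = ∧-elim e∈′ in
                                           ends-e , λ e≡u → true≢false (⌊⌋-true (e ≟ u) e≡u) (not-true e≉u))
                                         (insert-cases t (remove u ends) e∈)

      ends′-old : ∀ {e} → ends e ≡ true → e ≢ u → ends′ e ≡ true
      ends′-old ends-e e≢u = insert-old t (remove u ends) (∧-intro ends-e (not-false (⌊⌋-false (_ ≟ u) e≢u)))

      recoloured-old : ∀ {x} → x < t → colour′ x ≡ colour x
      recoloured-old = recolour-old t (colour u) colour

      class-of-u-below-u : ∀ {x} → P x ≡ true → x < t → colour x ≡ colour u → x ≤ u
      class-of-u-below-u Px x<t same =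
        let e , ends-e , same′ , x≤e = end-above Px x<t
        in subst (_ ≤_) (ends-distinct ends-e ends-u (trans same′ same)) x≤e

      -- Every point of u's class lies at or before u, so by convexity of reach it is apart from t as u is.
      apart-from-t : ∀ {x} → P x ≡ true → x < t → colour x ≡ colour u → Apart x t
      apart-from-t {x} Px x<t same with m≤n⇒m<n∨m≡n (class-of-u-below-u Px x<t same)
      ... | inj₂ refl = apart-u
      ... | inj₁ x<u  =
        let R-xu , _ = proper Px Pu x<u u<t same
            _ , R-tu = apart-u
        in ≢true⇒false (λ R-xt → true≢false (reach-right x<u (<⇒≤ u<t) R-xt) R-xu) ,
           ≢true⇒false (λ R-tx → true≢false (reach-left (<⇒≤ x<u) u<t R-tx) R-tu)

      proper′ : ∀ {x y} → P x ≡ true → P y ≡ true → x < y → y < suc t → colour′ x ≡ colour′ y → Apart x y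
      proper′ {x} {y} Px Py x<y y<1+t same with m<1+n⇒m<n∨m≡n y<1+t
      ... | inj₁ y<t  = proper Px Py x<y y<t (trans (sym (recoloured-old (<-trans x<y y<t)))
                                                    (trans same (recoloured-old y<t)))
      ... | inj₂ refl = apart-from-t Px x<y (trans (sym (recoloured-old x<y)) (trans same (recolour-new t _ colour)))

      end-above′ : ∀ {x} → P x ≡ true → x < suc t → ∃ λ e → ends′ e ≡ true × colour′ e ≡ colour′ x × x ≤ e
      end-above′ {x} Px x<1+t with m<1+n⇒m<n∨m≡n x<1+t
      ... | inj₂ refl = t , insert-new t (remove u ends) , refl , ≤-refl
      ... | inj₁ x<t with end-above Px x<t
      ...   | e , ends-e , same , x≤e with e ≟ u
      ...     | yes refl = t , insert-new t (remove u ends) ,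
                           trans (recolour-new t _ colour) (trans same (sym (recoloured-old x<t))) , <⇒≤ x<t
      ...     | no e≢u   = e , ends′-old ends-e e≢u ,
                           trans (recoloured-old (end<t ends-e)) (trans same (sym (recoloured-old x<t))) , x≤e

      ends-distinct′ : ∀ {e e′} → ends′ e ≡ true → ends′ e′ ≡ true → colour′ e ≡ colour′ e′ → e ≡ e′
      ends-distinct′ e∈ e′∈ same with ends′-cases e∈ | ends′-cases e′∈
      ... | inj₂ refl | inj₂ refl = refl
      ... | inj₁ (ends-e , e≢u) | inj₂ refl =
        ⊥-elim (e≢u (ends-distinct ends-e ends-u
                       (trans (sym (recoloured-old (end<t ends-e))) (trans same (recolour-new t _ colour)))))
      ... | inj₂ refl | inj₁ (ends-e′ , e′≢u) =
        ⊥-elim (e′≢u (ends-distinct ends-e′ ends-u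
                        (trans (sym (recoloured-old (end<t ends-e′))) (trans (sym same) (recolour-new t _ colour)))))
      ... | inj₁ (ends-e , _) | inj₁ (ends-e′ , _) =
        ends-distinct ends-e ends-e′ (trans (sym (recoloured-old (end<t ends-e)))
                                            (trans same (recoloured-old (end<t ends-e′))))

      count-ends′ : countBelow (suc t) ends′ ≡ countBelow t ends
      count-ends′ = trans (countBelow-insert t (remove u ends)) (sym (countBelow-remove t u<t ends-u))

      colour<′ : ∀ {x} → P x ≡ true → x < suc t → colour′ x < countBelow (suc t) ends′
      colour<′ {x} Px x<1+t rewrite count-ends′ with m<1+n⇒m<n∨m≡n x<1+t
      ... | inj₂ refl rewrite recolour-new t (colour u) colour = colour< Pu u<t
      ... | inj₁ x<t  rewrite recoloured-old x<t = colour< Px x<t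

      clique-bound′ : CliqueBound (suc t) ends′
      clique-bound′ {U} adm with true-or-false (U t) | true-or-false (U u)
      ... | inj₂ Ut | _ = clique-bound-if-t∉ adm Pt Ut
      ... | inj₁ Ut | inj₁ Uu =
        subst (HasReachClique (suc t) U) (sym count-U) (clique-bound-via-restriction adm clique-bound)
        where
        open ≡-Reasoning
        count-U : countBelow (suc t) (ends′ ∩ℕ U) ≡ countBelow t (ends ∩ℕ U)
        count-U = begin
          countBelow (suc t) (ends′ ∩ℕ U)          ≡⟨ countBelow-true t (∧-intro (insert-new t (remove u ends)) Ut) ⟩
          suc (countBelow t (ends′ ∩ℕ U))          ≡⟨ cong suc (countBelow-cong t λ {x} x<t →
                                                       trans (cong (_∧ U x) (insert-other t (remove u ends) (<⇒≢ x<t)))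
                                                             (∧-swapʳ (ends x) _ (U x))) ⟩
          suc (countBelow t (remove u (ends ∩ℕ U))) ≡⟨ countBelow-remove t u<t (∧-intro ends-u Uu) ⟨
          countBelow t (ends ∩ℕ U)                 ∎
      ... | inj₁ Ut | inj₂ Uu =
        subst (HasReachClique (suc t) U) (sym (countBelow-true t (∧-intro (insert-new t (remove u ends)) Ut)))
          (clique-bound-via-neighbours adm Ut clique-bound old-adjacent)
        where
        -- An end compatible with t lies before u, the greatest such, so U would contain u.
        old-adjacent : ∀ {x} → x < t → ends′ x ≡ true → U x ≡ true → ends x ≡ true × Adjacent x t ≡ true
        old-adjacent {x} x<t ends′-x Ux with ends′-cases ends′-x
        ... | inj₂ refl = ⊥-elim (<-irrefl refl x<t)
        ... | inj₁ (ends-x , _) with true-or-false (Adjacent x t)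
        ...   | inj₁ adj = ends-x , adj
        ...   | inj₂ ¬adj with Admissible.reaches-or-closed adm Ux
        ...     | inj₁ R-x[1+t] = ⊥-elim (true≢false (∨-introˡ (reach-right x<t (n≤1+n t) R-x[1+t])) ¬adj)
        ...     | inj₂ closed   = ⊥-elim (true≢false
                    (closed (greatest x<t (∧-intro ends-x (not-false ¬adj))) (m<n⇒m<1+n u<t) Pu) Uu)

  greedy : ∀ t → Greedy t
  greedy zero    = start
  greedy (suc t) with greedy t | P t in Pt
  ... | G | false = skip G Pt
  ... | G | true with greatest-below (Compatible (Greedy.ends G) t) t
  ...   | inj₁ none                               = open-class G Pt none
  ...   | inj₂ (u , compatible-u , u<t , greatest) = join-class G Pt compatible-u u<t greatest

  reach-colouring : ∀ N q → (∀ {x} → P x ≡ true → x < N) →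
    (∀ X → X ⊆ P → IsReachClique X → countBelow N X ≤ q) →
    ∃ λ (c : ℕ → ℕ) → (∀ {x} → P x ≡ true → c x < q) ×
      (∀ {x y} → P x ≡ true → P y ≡ true → x < y → c x ≡ c y → Apart x y)
  reach-colouring N q P<N clique≤q =
    colour , (λ Px → <-≤-trans (colour< Px (P<N Px)) classes≤q) ,
    (λ Px Py x<y → proper Px Py x<y (P<N Py))
    where
    open Greedy (greedy N)
    classes≤q : countBelow N ends ≤ q
    classes≤q =
      let X , X⊆P , clique , size≥ = clique-bound {P} record
            { ⊆P = id ; <t = P<N ; reaches-or-closed = λ _ → inj₂ λ _ _ Py → Py }
      in begin
        countBelow N ends          ≡⟨ countBelow-cong N (λ _ → sym (∧-absorbs-implied end∈P)) ⟩
        countBelow N (ends ∩ℕ P)   ≤⟨ size≥ ⟩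
        countBelow N X             ≤⟨ clique≤q X X⊆P clique ⟩
        q                          ∎
      where open ≤-Reasoning

-- The conflict graph G₁

module ConflictGraph {n} (H : IntervalHypergraph n) where

  node-≟ : (x y : Node n) → Dec (x ≡ y)
  node-≟ = ≡-dec _≟ᶠ_ (≡-dec _≟ᶠ_ _≟ᶠ_)

  isNode? : ∀ x → Dec (IsNode H x)
  isNode? x = isNode H x ≟ᵇ true

  adj? : ∀ x y → Dec (Adj H x y)
  adj? x@(i , j , v) y@(k , l , u) =
    (isNode? x ×-dec isNode? y ×-dec i ≟ᶠ k ×-dec j ≟ᶠ l ×-dec ¬? (v ≟ᶠ u)) ⊎-dec
    (isNode? x ×-dec isNode? y ×-dec ¬? (u ≟ᶠ v) ×-dec
      ((inI i j u ∧ inI i j v) ≟ᵇ true ⊎-dec (inI k l u ∧ inI k l v) ≟ᵇ true))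

  adj-sym : ∀ x y → Adj H x y → Adj H y x
  adj-sym x y (inj₁ (x∈ , y∈ , refl , refl , v≢u)) = inj₁ (y∈ , x∈ , refl , refl , v≢u ∘ sym)
  adj-sym (i , j , v) (k , l , u) (inj₂ (x∈ , y∈ , u≢v , inj₁ both)) =
    inj₂ (y∈ , x∈ , u≢v ∘ sym , inj₂ (trans (∧-comm (inI i j v) _) both))
  adj-sym (i , j , v) (k , l , u) (inj₂ (x∈ , y∈ , u≢v , inj₂ both)) =
    inj₂ (y∈ , x∈ , u≢v ∘ sym , inj₁ (trans (∧-comm (inI k l v) _) both))

  Joinable : NodeSet n → Node n → Set
  Joinable K x = IsNode H x × (∀ y → K y ≡ true → ¬ y ≡ x → Adj H x y)

  joinable? : ∀ K x → Dec (Joinable K x)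
  joinable? K x = isNode? x ×-dec all-nodes? (λ y → K y ≟ᵇ true →-dec ¬? (node-≟ y x) →-dec adj? x y)

  join : NodeSet n → Node n → NodeSet n
  join K x y = K y ∨ (⌊ joinable? K x ⌋ ∧ ⌊ node-≟ y x ⌋)

  join-cases : ∀ K x {y} → join K x y ≡ true → K y ≡ true ⊎ (Joinable K x × y ≡ x)
  join-cases K x {y} y∈ = map₂ (λ new → let j , y≡x = ∧-elim new
                                                 in ⌊⌋⇒ (joinable? K x) j , ⌊⌋⇒ (node-≟ y x) y≡x)
                                        (∨-elim y∈)

  join-clique : ∀ K x → IsClique H K → IsClique H (join K x)
  join-clique K x (K⊆V , K-adj) = ⊆V , adj
    where
    ⊆V : SubsetOfV H (join K x)
    ⊆V y y∈ = [ K⊆V y , (λ { (j , refl) → proj₁ j }) ]′ (join-cases K x y∈)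
    adj : ∀ a b → join K x a ≡ true → join K x b ≡ true → a ≢ b → Adj H a b
    adj a b a∈ b∈ a≢b with join-cases K x a∈ | join-cases K x b∈
    ... | inj₁ Ka       | inj₁ Kb       = K-adj a b Ka Kb a≢b
    ... | inj₁ Ka       | inj₂ (j , refl) = adj-sym b a (proj₂ j a Ka a≢b)
    ... | inj₂ (j , refl) | inj₁ Kb     = proj₂ j b Kb (a≢b ∘ sym)
    ... | inj₂ (_ , refl) | inj₂ (_ , refl) = ⊥-elim (a≢b refl)

  saturate : List (Node n) → NodeSet n → NodeSet n
  saturate []       K = K
  saturate (x ∷ xs) K = saturate xs (join K x)

  saturate-⊇ : ∀ xs K {y} → K y ≡ true → saturate xs K y ≡ true
  saturate-⊇ []       K Ky = Ky
  saturate-⊇ (x ∷ xs) K Ky = saturate-⊇ xs (join K x) (∨-introˡ Ky)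

  saturate-clique : ∀ xs K → IsClique H K → IsClique H (saturate xs K)
  saturate-clique []       K clique = clique
  saturate-clique (x ∷ xs) K clique = saturate-clique xs (join K x) (join-clique K x clique)

  saturate-maximal : ∀ xs K K′ → IsClique H K′ → (∀ y → saturate xs K y ≡ true → K′ y ≡ true) →
    ∀ {x} → x ∈ xs → K′ x ≡ true → saturate xs K x ≡ true
  saturate-maximal (y ∷ ys) K K′ clique′ ⊆K′ (there x∈ys) K′x = saturate-maximal ys (join K y) K′ clique′ ⊆K′ x∈ys K′x
  saturate-maximal (x ∷ ys) K K′ (K′⊆V , K′-adj) ⊆K′ (here refl) K′x =
    saturate-⊇ ys (join K x) (∨-introʳ {K x} (∧-intro (⌊⌋-true (joinable? K x) joinable) (⌊⌋-true (node-≟ x x) refl)))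
    where
    joinable : Joinable K x
    joinable = K′⊆V x K′x , λ z Kz z≢x →
      K′-adj x z K′x (⊆K′ z (saturate-⊇ ys (join K x) (∨-introˡ Kz))) (z≢x ∘ sym)

  all-nodes : List (Node n)
  all-nodes = cartesianProduct (allFin n) (cartesianProduct (allFin n) (allFin n))

  ∈-all-nodes : ∀ x → x ∈ all-nodes
  ∈-all-nodes (i , j , v) = ∈-cartesianProduct⁺ (∈-allFin i) (∈-cartesianProduct⁺ (∈-allFin j) (∈-allFin v))

  extend-to-maximal : ∀ Y → IsClique H Y →
    ∃ λ K → IsMaximalClique H K × (∀ x → Y x ≡ true → K x ≡ true)
  extend-to-maximal Y clique =
    saturate all-nodes Y ,
    (saturate-clique all-nodes Y clique ,
     λ K′ clique′ ⊆K′ x → saturate-maximal all-nodes Y K′ clique′ ⊆K′ (∈-all-nodes x)) ,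
    λ x → saturate-⊇ all-nodes Y

-- From a conflict-free colouring to a good set

module FromColouring {n q} (H : IntervalHypergraph n) (C : Colouring n q)
                     (conflict-free : IsConflictFree {n} {q} H C) where

  vertex : Node n → Fin n
  vertex (_ , _ , v) = v

  ColourClass : Fin n → Fin n → Fin (suc q) → Fin n → Bool
  ColourClass i j c u = inI i j u ∧ ⌊ C u ≟ᶠ c ⌋

  -- i is a dummy value for the intervals not in 𝓘.
  chosen-by : ∀ i j b → edge H i j ≡ b → Fin n
  chosen-by i j true  e = let _ , _ , once = conflict-free i j e
                          in proj₁ (count-witness (ColourClass i j _) (≤-reflexive (sym once)))
  chosen-by i j false _ = i

  chosen : Fin n → Fin n → Fin n
  chosen i j = chosen-by i j (edge H i j) refl

  chosen-unique : ∀ {i j} → edge H i j ≡ true →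
    ∃ λ c → c ≢ zero × count (ColourClass i j c) ≡ 1 × ColourClass i j c (chosen i j) ≡ true
  chosen-unique {i} {j} = by (edge H i j) refl
    where
    by : ∀ b (e : edge H i j ≡ b) → b ≡ true →
      ∃ λ c → c ≢ zero × count (ColourClass i j c) ≡ 1 × ColourClass i j c (chosen-by i j b e) ≡ true
    by true e _ = let c , c≢0 , once = conflict-free i j e
                  in c , c≢0 , once , proj₂ (count-witness (ColourClass i j c) (≤-reflexive (sym once)))

  S : NodeSet n
  S (i , j , v) = edge H i j ∧ ⌊ v ≟ᶠ chosen i j ⌋

  S-cases : ∀ {i j v} → S (i , j , v) ≡ true → edge H i j ≡ true × v ≡ chosen i j
  S-cases {i} {j} {v} x∈ = let e , v≟ = ∧-elim x∈ in e , ⌊⌋⇒ (v ≟ᶠ chosen i j) v≟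

  chosen∈I : ∀ {i j} → edge H i j ≡ true → inI i j (chosen i j) ≡ true
  chosen∈I e = let _ , _ , _ , in-class = chosen-unique e in proj₁ (∧-elim in-class)

  S⊆V : SubsetOfV H S
  S⊆V (i , j , v) x∈ with S-cases x∈
  ... | e , refl = ∧-intro e (chosen∈I e)

  S-meets-Q₁-once : ∀ i j → edge H i j ≡ true → size (S ∩ Q₁ i j) ≡ 1
  S-meets-Q₁-once i j e =
    size-single (S ∩ Q₁ i j) (i , j , chosen i j)
      (∧-intro (∧-intro e (⌊⌋-true (_ ≟ᶠ _) refl))
               (∧-intro (⌊⌋-true (i ≟ᶠ i) refl) (∧-intro (⌊⌋-true (j ≟ᶠ j) refl) (chosen∈I e))))
      only
    where
    only : ∀ x → (S ∩ Q₁ i j) x ≡ true → x ≡ (i , j , chosen i j)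
    only (k , l , u) x∈ =
      let S-x , Q-x = ∧-elim x∈ ; i≟k , rest = ∧-elim Q-x ; j≟l , _ = ∧-elim rest
      in help (⌊⌋⇒ (i ≟ᶠ k) i≟k) (⌊⌋⇒ (j ≟ᶠ l) j≟l) (proj₂ (S-cases {k} {l} {u} S-x))
      where
      help : i ≡ k → j ≡ l → u ≡ chosen k l → (k , l , u) ≡ (i , j , chosen i j)
      help refl refl refl = refl

  S-meets-clique : ∀ K → IsClique H K → size (S ∩ K) ≤ q
  S-meets-clique K (_ , K-adj) = size-≤-colours (S ∩ K) (C ∘ vertex) nonzero injective
    where
    nonzero : ∀ x → (S ∩ K) x ≡ true → C (vertex x) ≢ zero
    nonzero (i , j , v) x∈ with S-cases (proj₁ (∧-elim x∈))
    ... | e , refl = let c , c≢0 , _ , in-class = chosen-unique e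
                     in c≢0 ∘ trans (sym (⌊⌋⇒ (_ ≟ᶠ c) (proj₂ (∧-elim in-class))))

    same-colour-in : ∀ {i j u} → edge H i j ≡ true → inI i j u ≡ true →
      C u ≡ C (chosen i j) → u ≡ chosen i j
    same-colour-in e u∈I same =
      let c , _ , once , in-class = chosen-unique e
          C-chosen = ⌊⌋⇒ (_ ≟ᶠ c) (proj₂ (∧-elim in-class))
      in count≡1⇒unique (ColourClass _ _ c) once
           (∧-intro u∈I (⌊⌋-true (_ ≟ᶠ c) (trans same C-chosen))) in-class

    injective : ∀ x y → (S ∩ K) x ≡ true → (S ∩ K) y ≡ true → C (vertex x) ≡ C (vertex y) → x ≡ y
    injective x@(i , j , v) y@(k , l , u) x∈ y∈ same with node-≟ x y
      where open ConflictGraph H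
    ... | yes x≡y = x≡y
    ... | no  x≢y with S-cases (proj₁ (∧-elim x∈)) | S-cases (proj₁ (∧-elim y∈))
    ...   | e , refl | e′ , refl with K-adj x y (proj₂ (∧-elim x∈)) (proj₂ (∧-elim y∈)) x≢y
    ...     | inj₁ (_ , _ , refl , refl , v≢u) = ⊥-elim (v≢u refl)
    ...     | inj₂ (_ , _ , u≢v , inj₁ both) = ⊥-elim (u≢v (same-colour-in e (proj₁ (∧-elim both)) (sym same)))
    ...     | inj₂ (_ , _ , u≢v , inj₂ both) = ⊥-elim (u≢v (sym (same-colour-in e′ (proj₂ (∧-elim {inI k l (chosen k l)} both)) same)))

  good : GoodSet H q S
  good = S⊆V , S-meets-Q₁-once , λ K K∈𝓠₂ → S-meets-clique K (proj₁ (proj₁ K∈𝓠₂))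

-- From a good set to a conflict-free colouring

module FromGoodSet {n q′} (H : IntervalHypergraph n) (S : NodeSet n)
                   (good : GoodSet H (suc q′) S) where

  S⊆V : SubsetOfV H S
  S⊆V = proj₁ good

  Interval : Set
  Interval = Fin n × Fin n

  node : Interval → Fin n → Node n
  node I v = proj₁ I , proj₂ I , v

  _∈ᴵ_ : Fin n → Interval → Bool
  v ∈ᴵ I = inI (proj₁ I) (proj₂ I) v

  _∈ℕ_ : ℕ → Interval → Set
  y ∈ℕ I = toℕ (proj₁ I) ≤ y × y ≤ toℕ (proj₂ I)

  ∈ᴵ⇒∈ℕ : ∀ {v} I → v ∈ᴵ I ≡ true → toℕ v ∈ℕ I
  ∈ᴵ⇒∈ℕ {v} (i , j) v∈ = let i≤v , v≤j = ∧-elim v∈ in ⌊⌋⇒ (i ≤?ᶠ v) i≤v , ⌊⌋⇒ (v ≤?ᶠ j) v≤j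

  ∈ℕ⇒∈ᴵ : ∀ {v} I → toℕ v ∈ℕ I → v ∈ᴵ I ≡ true
  ∈ℕ⇒∈ᴵ {v} (i , j) (i≤v , v≤j) = ∧-intro (⌊⌋-true (i ≤?ᶠ v) i≤v) (⌊⌋-true (v ≤?ᶠ j) v≤j)

  S-inside : ∀ {I v} → S (node I v) ≡ true → v ∈ᴵ I ≡ true
  S-inside {I} {v} x∈ = proj₂ (∧-elim {edge H (proj₁ I) (proj₂ I)} (S⊆V (node I v) x∈))

  S-insideℕ : ∀ I v → S (node I v) ≡ true → toℕ v ∈ℕ I
  S-insideℕ I v x∈ = ∈ᴵ⇒∈ℕ I (S-inside {I} {v} x∈)

  some-interval? : (Interval → Bool) → Bool
  some-interval? f = ⌊ any? (λ i → any? (λ j → f (i , j) ≟ᵇ true)) ⌋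

  some-interval-intro : ∀ f I → f I ≡ true → some-interval? f ≡ true
  some-interval-intro f (i , j) fI = ⌊⌋-true (any? _) (i , j , fI)

  some-interval-elim : ∀ f → some-interval? f ≡ true → ∃ λ I → f I ≡ true
  some-interval-elim f found = let i , j , fI = ⌊⌋⇒ (any? _) found in (i , j) , fI

  IsChosen : Fin n → Bool
  IsChosen v = some-interval? λ I → S (node I v)

  Reaches : Fin n → Fin n → Bool
  Reaches a b = some-interval? λ I → S (node I a) ∧ b ∈ᴵ I

  liftℕ : (Fin n → Bool) → ℕSet
  liftℕ f k with k <? n
  ... | yes k<n = f (fromℕ< k<n)
  ... | no  _   = false

  liftℕ-toℕ : ∀ f i → liftℕ f (toℕ i) ≡ f i
  liftℕ-toℕ f i with toℕ i <? n
  ... | yes i<n = cong f (fromℕ<-toℕ i i<n)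
  ... | no  i≮n = contradiction (toℕ<n i) i≮n

  liftℕ-elim : ∀ f {k} → liftℕ f k ≡ true → ∃ λ i → toℕ i ≡ k × f i ≡ true
  liftℕ-elim f {k} fk with k <? n
  ... | yes k<n = fromℕ< k<n , toℕ-fromℕ< k<n , fk

  P : ℕSet
  P = liftℕ IsChosen

  R : ℕ → ℕ → Bool
  R x y = liftℕ (λ a → liftℕ (Reaches a) y) x

  R-intro : ∀ {I a} y → S (node I a) ≡ true → y ∈ℕ I → R (toℕ a) y ≡ true
  R-intro {I@(i , j)} {a} y chosen (i≤y , y≤j) =
    let b = fromℕ< (≤-<-trans y≤j (toℕ<n j)) ; toℕ-b = toℕ-fromℕ< (≤-<-trans y≤j (toℕ<n j))
    in trans (liftℕ-toℕ _ a) (trans (sym (cong (liftℕ (Reaches a)) toℕ-b)) (trans (liftℕ-toℕ _ b)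
         (some-interval-intro _ I (∧-intro chosen (∈ℕ⇒∈ᴵ I (subst (_∈ℕ I) (sym toℕ-b) (i≤y , y≤j)))))))

  R-elim : ∀ {x y} → R x y ≡ true →
    ∃₂ λ a I → toℕ a ≡ x × S (node I a) ≡ true × y ∈ℕ I
  R-elim Rxy =
    let a , toℕ-a , Ray = liftℕ-elim _ Rxy
        b , toℕ-b , Rab = liftℕ-elim _ Ray
        I , both = some-interval-elim _ Rab
        chosen , b∈I = ∧-elim both
    in a , I , toℕ-a , chosen , subst (_∈ℕ I) toℕ-b (∈ᴵ⇒∈ℕ I b∈I)

  reach-right : ∀ {x y z} → x < y → y ≤ z → R x z ≡ true → R x y ≡ true
  reach-right {x} {y} x<y y≤z Rxz =
    let a , I , toℕ-a , chosen , (_ , z≤j) = R-elim Rxz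
        i≤a , _ = S-insideℕ I a chosen
    in subst (λ x → R x y ≡ true) toℕ-a
         (R-intro {I} {a} y chosen (≤-trans i≤a (subst (_≤ y) (sym toℕ-a) (<⇒≤ x<y)) , ≤-trans y≤z z≤j))

  reach-left : ∀ {x y z} → z ≤ y → y < x → R x z ≡ true → R x y ≡ true
  reach-left {x} {y} z≤y y<x Rxz =
    let a , I , toℕ-a , chosen , (i≤z , _) = R-elim Rxz
        _ , a≤j = S-insideℕ I a chosen
    in subst (λ x → R x y ≡ true) toℕ-a
         (R-intro {I} {a} y chosen (≤-trans i≤z z≤y , ≤-trans (subst (y ≤_) (sym toℕ-a) (<⇒≤ y<x)) a≤j))

  open ReachColouring P R reach-right reach-left

  P<n : ∀ {x} → P x ≡ true → x < n
  P<n Px = let i , toℕ-i , _ = liftℕ-elim IsChosen Px in subst (_< n) toℕ-i (toℕ<n i)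

  record ColourClique (Z : ℕSet) (I : Fin n → Interval) : Set where
    field
      in-S   : ∀ {v} → Z (toℕ v) ≡ true → S (node (I v) v) ≡ true
      joined : ∀ {v w} → Z (toℕ v) ≡ true → Z (toℕ w) ≡ true → v ≢ w →
               ColourE H (node (I v) v) (node (I w) w)

  spanning-interval : ∀ {Z m} → Z ⊆ P → IsReachClique Z → Z m ≡ true →
    ∃₂ λ a J → Z (toℕ a) ≡ true × S (node J a) ≡ true × (∀ {v} → Z (toℕ v) ≡ true → toℕ v ∈ℕ J)
  spanning-interval {Z} {m} Z⊆P clique Zm with least-below Z n | greatest-below Z n
  ... | inj₁ none | _ = ⊥-elim (true≢false Zm (none (P<n (Z⊆P Zm))))
  ... | _ | inj₁ none = ⊥-elim (true≢false Zm (none (P<n (Z⊆P Zm))))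
  ... | inj₂ (lo , Zlo , lo<n , least) | inj₂ (hi , Zhi , hi<n , greatest)
    with m≤n⇒m<n∨m≡n (least hi<n Zhi)
  ... | inj₂ refl =
    let a , toℕ-a , chosen-a = liftℕ-elim IsChosen (Z⊆P Zlo)
        J , a-chosen = some-interval-elim _ chosen-a
        i≤a , a≤j = S-insideℕ J a a-chosen
        at-lo : ∀ {v} → Z (toℕ v) ≡ true → toℕ v ≡ lo
        at-lo {v} Zv = ≤-antisym (greatest (toℕ<n v) Zv) (least (toℕ<n v) Zv)
    in a , J , subst (λ k → Z k ≡ true) (sym toℕ-a) Zlo , a-chosen ,
       λ {v} Zv → subst (_∈ℕ J) (trans toℕ-a (sym (at-lo Zv))) (i≤a , a≤j)
  ... | inj₁ lo<hi with ∨-elim (clique Zlo Zhi lo<hi)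
  ...   | inj₁ R-lo-hi =
    let a , J , toℕ-a , chosen , (_ , hi≤j) = R-elim R-lo-hi
        i≤a , _ = S-insideℕ J a chosen
    in a , J , subst (λ k → Z k ≡ true) (sym toℕ-a) Zlo , chosen ,
       λ {v} Zv → ≤-trans (subst (toℕ (proj₁ J) ≤_) toℕ-a i≤a) (least (toℕ<n v) Zv) ,
              ≤-trans (greatest (toℕ<n v) Zv) hi≤j
  ...   | inj₂ R-hi-lo =
    let a , J , toℕ-a , chosen , (i≤lo , _) = R-elim R-hi-lo
        _ , a≤j = S-insideℕ J a chosen
    in a , J , subst (λ k → Z k ≡ true) (sym toℕ-a) Zhi , chosen ,
       λ {v} Zv → ≤-trans i≤lo (least (toℕ<n v) Zv) ,
              ≤-trans (greatest (toℕ<n v) Zv) (subst (_≤ toℕ (proj₂ J)) toℕ-a a≤j)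

  with-interval : Fin n → Interval → (Fin n → Interval) → Fin n → Interval
  with-interval a J I v = if ⌊ v ≟ᶠ a ⌋ then J else I v

  add-spanning : ∀ {Z a J I} → ColourClique (remove (toℕ a) Z) I →
    S (node J a) ≡ true → (∀ {v} → Z (toℕ v) ≡ true → toℕ v ∈ℕ J) →
    ColourClique Z (with-interval a J I)
  add-spanning {Z} {a} {J} {I} cc chosen spans = record { in-S = in-S′ ; joined = joined′ }
    where
    open ColourClique cc
    kept : ∀ {v} → Z (toℕ v) ≡ true → v ≢ a → remove (toℕ a) Z (toℕ v) ≡ true
    kept Zv v≢a = ∧-intro Zv (not-false (⌊⌋-false (_ ≟ _) (v≢a ∘ toℕ-injective)))

    in-S′ : ∀ {v} → Z (toℕ v) ≡ true → S (node (with-interval a J I v) v) ≡ true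
    in-S′ {v} Zv with v ≟ᶠ a
    ... | yes refl = chosen
    ... | no  v≢a  = in-S (kept Zv v≢a)

    joined′ : ∀ {v w} → Z (toℕ v) ≡ true → Z (toℕ w) ≡ true → v ≢ w →
      ColourE H (node (with-interval a J I v) v) (node (with-interval a J I w) w)
    joined′ {v} {w} Zv Zw v≢w with v ≟ᶠ a | w ≟ᶠ a
    ... | yes refl | yes refl = ⊥-elim (v≢w refl)
    ... | yes refl | no  w≢a  =
      S⊆V _ chosen , S⊆V _ (in-S (kept Zw w≢a)) , w≢a ,
      inj₁ (∧-intro (∈ℕ⇒∈ᴵ J (spans Zw)) (S-inside chosen))
    ... | no  v≢a  | yes refl =
      S⊆V _ (in-S (kept Zv v≢a)) , S⊆V _ chosen , v≢a ∘ sym ,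
      inj₂ (∧-intro (S-inside chosen) (∈ℕ⇒∈ᴵ J (spans Zv)))
    ... | no  v≢a  | no  w≢a  = joined (kept Zv v≢a) (kept Zw w≢a) v≢w

  colour-clique-of-empty : ∀ {Z} → (∀ {e} → e < n → Z e ≡ false) → ∃ (ColourClique Z)
  colour-clique-of-empty none = (λ v → v , v) , record
    { in-S   = λ {v} Zv → ⊥-elim (true≢false Zv (none (toℕ<n v)))
    ; joined = λ {v} Zv → ⊥-elim (true≢false Zv (none (toℕ<n v))) }

  colour-clique : ∀ k Z → Z ⊆ P → IsReachClique Z → countBelow n Z ≤ k → ∃ (ColourClique Z)
  colour-clique k Z Z⊆P clique size≤ with least-below Z n
  ... | inj₁ none = colour-clique-of-empty none
  colour-clique zero Z Z⊆P clique size≤ | inj₂ (m , Zm , m<n , _) =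
    ⊥-elim (n≮0 (subst (_≤ 0) (countBelow-remove n m<n Zm) size≤))
  colour-clique (suc k) Z Z⊆P clique size≤ | inj₂ (m , Zm , _) =
    let a , J , Za , chosen , spans = spanning-interval Z⊆P clique Zm
        I , cc = colour-clique k (remove (toℕ a) Z) (Z⊆P ∘ proj₁ ∘ ∧-elim)
                   (λ x∈ y∈ → clique (proj₁ (∧-elim x∈)) (proj₁ (∧-elim y∈)))
                   (≤-pred (subst (_≤ suc k) (countBelow-remove n (toℕ<n a) Za) size≤))
    in with-interval a J I , add-spanning cc chosen spans

  -- The nodes of a colour clique form a clique of G₁; when there are two of them it
  -- lies in a member of 𝓠₂, which S meets at most q times.
  reach-clique-bound : ∀ Z → Z ⊆ P → IsReachClique Z → countBelow n Z ≤ suc q′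
  reach-clique-bound Z Z⊆P clique with count {n} (Z ∘ toℕ) ≤? 1
  ... | yes size≤1 = ≤-trans (≤-reflexive (countBelow-count n Z)) (≤-trans size≤1 (s≤s z≤n))
  ... | no  size≰1 =
    let v , w , v≢w , Zv , Zw = count-pair (Z ∘ toℕ) (≰⇒> size≰1)
        K , maximal , Y⊆K = extend-to-maximal Y Y-clique
    in begin
      countBelow n Z   ≡⟨ trans (countBelow-count n Z) (sym (size-nodesOn (Z ∘ toℕ) I)) ⟩
      size Y           ≤⟨ size-mono Y (S ∩ K) (λ x x∈ → ∧-intro (Y⊆S x x∈) (Y⊆K x x∈)) ⟩
      size (S ∩ K)     ≤⟨ proj₂ (proj₂ good) K (maximal , _ , _ , Y⊆K _ (nodesOn-intro (Z ∘ toℕ) I Zv) ,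
                                                 Y⊆K _ (nodesOn-intro (Z ∘ toℕ) I Zw) , joined Zv Zw v≢w) ⟩
      suc q′           ∎
    where
    I : Fin n → Interval
    I = proj₁ (colour-clique (countBelow n Z) Z Z⊆P clique ≤-refl)
    cc : ColourClique Z I
    cc = proj₂ (colour-clique (countBelow n Z) Z Z⊆P clique ≤-refl)
    open ColourClique cc
    open ConflictGraph H using (extend-to-maximal)
    open ≤-Reasoning
    Y : NodeSet n
    Y = nodesOn (Z ∘ toℕ) I

    Y⊆S : ∀ x → Y x ≡ true → S x ≡ true
    Y⊆S (i , j , u) x∈ =
      let I-u , Zu = nodesOn-elim (Z ∘ toℕ) I x∈
      in subst (λ J → S (node J u) ≡ true) (sym I-u) (in-S Zu)

    Y-clique : IsClique H Y
    Y-clique = (λ x x∈ → S⊆V x (Y⊆S x x∈)) , adjacent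
      where
      adjacent : ∀ x y → Y x ≡ true → Y y ≡ true → x ≢ y → Adj H x y
      adjacent (i , j , v) (k , l , u) x∈ y∈ x≢y
        with nodesOn-elim (Z ∘ toℕ) I x∈ | nodesOn-elim (Z ∘ toℕ) I y∈ | v ≟ᶠ u
      ... | I-v , _  | I-u , _  | yes refl = ⊥-elim (x≢y (cong (λ J → node J v) (trans I-v (sym I-u))))
      ... | I-v , Zv | I-u , Zu | no  v≢u  =
        inj₂ (subst₂ (λ J J′ → ColourE H (node J v) (node J′ u)) (sym I-v) (sym I-u) (joined Zv Zu v≢u))

  reach-colouring-of-P : ∃ λ (c : ℕ → ℕ) → (∀ {x} → P x ≡ true → c x < suc q′) ×
      (∀ {x y} → P x ≡ true → P y ≡ true → x < y → c x ≡ c y → Apart x y)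
  reach-colouring-of-P = reach-colouring n (suc q′) P<n reach-clique-bound

  c : ℕ → ℕ
  c = proj₁ reach-colouring-of-P

  c<q : ∀ {x} → P x ≡ true → c x < suc q′
  c<q = proj₁ (proj₂ reach-colouring-of-P)

  c-proper : ∀ {x y} → P x ≡ true → P y ≡ true → x < y → c x ≡ c y → Apart x y
  c-proper = proj₂ (proj₂ reach-colouring-of-P)

  colouring : Colouring n (suc q′)
  colouring v = if IsChosen v then suc (c (toℕ v) mod suc q′) else zero

  P-toℕ : ∀ {v} → IsChosen v ≡ true → P (toℕ v) ≡ true
  P-toℕ {v} chosen = trans (liftℕ-toℕ IsChosen v) chosen

  colouring-chosen : ∀ {v} → IsChosen v ≡ true → colouring v ≡ suc (c (toℕ v) mod suc q′)
  colouring-chosen {v} chosen = cong (if_then suc (c (toℕ v) mod suc q′) else zero) chosen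

  same-colour : ∀ {u v} → IsChosen u ≡ true → IsChosen v ≡ true →
    colouring u ≡ colouring v → c (toℕ u) ≡ c (toℕ v)
  same-colour {u} {v} chosen-u chosen-v same = begin
    c (toℕ u)               ≡⟨ m<n⇒m%n≡m (c<q (P-toℕ chosen-u)) ⟨
    c (toℕ u) % suc q′      ≡⟨ toℕ-fromℕ< _ ⟨
    toℕ (c (toℕ u) mod suc q′) ≡⟨ cong toℕ (suc-injective (trans (sym (colouring-chosen chosen-u))
                                                                   (trans same (colouring-chosen chosen-v)))) ⟩
    toℕ (c (toℕ v) mod suc q′) ≡⟨ toℕ-fromℕ< _ ⟩
    c (toℕ v) % suc q′      ≡⟨ m<n⇒m%n≡m (c<q (P-toℕ chosen-v)) ⟩
    c (toℕ v)               ∎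
    where open ≡-Reasoning

  colouring-unchosen : ∀ {v} → IsChosen v ≡ false → colouring v ≡ zero
  colouring-unchosen {v} unchosen = cong (if_then suc (c (toℕ v) mod suc q′) else zero) unchosen

  chosen-nonzero : ∀ {v} → IsChosen v ≡ true → colouring v ≢ zero
  chosen-nonzero chosen v≡0 = zero≢suc (trans (sym v≡0) (colouring-chosen chosen))

  -- Another vertex u of I with the colour of v would be chosen too, and v reaches u.
  chosen-colour-unique : ∀ {I v} → S (node I v) ≡ true →
    count (λ u → u ∈ᴵ I ∧ ⌊ colouring u ≟ᶠ colouring v ⌋) ≡ 1
  chosen-colour-unique {I} {v} S-v =
    count-single _ v (∧-intro (S-inside {I} {v} S-v) (⌊⌋-true (colouring v ≟ᶠ _) refl)) only-v
    where
    chosen-v : IsChosen v ≡ true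
    chosen-v = some-interval-intro _ I S-v

    v-reaches : ∀ {u} → u ∈ᴵ I ≡ true → R (toℕ v) (toℕ u) ≡ true
    v-reaches {u} u∈I = R-intro {I} {v} (toℕ u) S-v (∈ᴵ⇒∈ℕ I u∈I)

    only-v : ∀ u → (u ∈ᴵ I ∧ ⌊ colouring u ≟ᶠ colouring v ⌋) ≡ true → u ≡ v
    only-v u u∈ =
      let u∈I , same? = ∧-elim {u ∈ᴵ I} u∈
          same = ⌊⌋⇒ (colouring u ≟ᶠ colouring v) same?
      in [ (λ chosen-u → by-position u∈I chosen-u same (<-cmp (toℕ u) (toℕ v)))
         , (λ unchosen → ⊥-elim (chosen-nonzero chosen-v (trans (sym same) (colouring-unchosen unchosen)))) ]′
         (true-or-false (IsChosen u))
      where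
      by-position : u ∈ᴵ I ≡ true → IsChosen u ≡ true → colouring u ≡ colouring v →
        Tri (toℕ u < toℕ v) (toℕ u ≡ toℕ v) (toℕ v < toℕ u) → u ≡ v
      by-position u∈I chosen-u same (tri≈ _ eq _)  = toℕ-injective eq
      by-position u∈I chosen-u same (tri< u<v _ _) = ⊥-elim (true≢false (v-reaches u∈I)
        (proj₂ (c-proper (P-toℕ chosen-u) (P-toℕ chosen-v) u<v (same-colour chosen-u chosen-v same))))
      by-position u∈I chosen-u same (tri> _ _ v<u) = ⊥-elim (true≢false (v-reaches u∈I)
        (proj₁ (c-proper (P-toℕ chosen-v) (P-toℕ chosen-u) v<u (sym (same-colour chosen-u chosen-v same)))))

  chosen-in : ∀ {i j} → edge H i j ≡ true → ∃ λ v → S (i , j , v) ≡ true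
  chosen-in {i} {j} e with nonempty? (S ∩ Q₁ i j)
  ... | no  empty = ⊥-elim (0≢1+n (trans (sym (size-zero _ λ x → ≢true⇒false λ x∈ → empty (x , x∈)))
                                          (proj₁ (proj₂ good) i j e)))
  ... | yes ((k , l , v) , x∈) =
    let S-x , Q-x = ∧-elim {S (k , l , v)} x∈ ; i≟k , rest = ∧-elim Q-x ; j≟l , _ = ∧-elim rest
    in v , subst₂ (λ i′ j′ → S (i′ , j′ , v) ≡ true) (sym (⌊⌋⇒ (i ≟ᶠ k) i≟k)) (sym (⌊⌋⇒ (j ≟ᶠ l) j≟l)) S-x

  conflict-free : IsConflictFree {n} {suc q′} H colouring
  conflict-free i j e =
    let v , S-v = chosen-in e
    in colouring v , chosen-nonzero (some-interval-intro _ (i , j) S-v) , chosen-colour-unique {i , j} S-v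


lemma4 : (n : ℕ) (H : IntervalHypergraph n) (q : ℕ) → 1 ≤ q →
    (∃[ S ] GoodSet H q S) ⇔ (∃[ C ] IsConflictFree {n} {q} H C)
lemma4 n H (suc q′) _ = mk⇔
  (λ (S , good) → FromGoodSet.colouring H S good , FromGoodSet.conflict-free H S good)
  (λ (C , conflict-free) → FromColouring.S H C conflict-free , FromColouring.good H C conflict-free)
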